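{- Let $A\subseteq\omega$ be $m$-rigid and let $S,T\subseteq\omega$ be computable sets such that $T\setminus S$ is infinite. For a computable set $U$ let $E_U=\{\langle x,0\rangle:x\in\omega\}\cup\{\langle x,1\rangle:x\in U\}$, fix a computable bijection $\tau_U:\omega\to E_U$, and let $C_U=\{n\in\omega:\pi_1(\tau_U(n))\in A\}$. Then $C_T\not\le_1 C_S$.
   Context: $\langle\cdot,\cdot\rangle$ is a standard computable pairing function on $\omega$ with computable projections $\pi_1,\pi_2$. A set $A$ is $m$-rigid if for every total computable $f$ with $x\in A\iff f(x)\in A$ for all $x$, $f(x)=x$ for all but finitely many $x$. $X\le_1Y$ means there is an injective total computable $f$ with $x\in X\iff f(x)\in Y$ for all $x$. -}

module Defs where

open import Data.Nat using (ℕ; zero; suc; _+_; _≤_; _<_)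
open import Data.Fin using (Fin)
open import Data.Vec using (Vec; []; _∷_; lookup)
open import Data.Product using (Σ; _×_; _,_; proj₁; proj₂)
open import Data.Sum using (_⊎_)
open import Relation.Binary.PropositionalEquality using (_≡_)
open import Relation.Nullary using (¬_)
open import Function.Bundles using (_⇔_)
open import Function.Definitions using (Injective)

data Code : ℕ → Set where
  zeroC : ∀ {n} → Code n
  succC : Code 1
  projC : ∀ {n} → Fin n → Code n
  compC : ∀ {m n} → Code m → Vec (Code n) m → Code n
  precC : ∀ {n} → Code n → Code (suc (suc n)) → Code (suc n)
  muC   : ∀ {n} → Code (suc n) → Code n

mutual
  data Eval : ∀ {n} → Code n → Vec ℕ n → ℕ → Set where
    ezero : ∀ {n} {xs : Vec ℕ n} → Eval zeroC xs 0
    esucc : ∀ {x} → Eval succC (x ∷ []) (suc x)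
    eproj : ∀ {n} {xs : Vec ℕ n} (i : Fin n) → Eval (projC i) xs (lookup xs i)
    ecomp : ∀ {m n} {f : Code m} {gs : Vec (Code n) m} {xs ys y}
          → EvalVec gs xs ys → Eval f ys y → Eval (compC f gs) xs y
    eprec0 : ∀ {n} {g : Code n} {h} {xs y}
           → Eval g xs y → Eval (precC g h) (0 ∷ xs) y
    eprecS : ∀ {n} {g : Code n} {h} {xs k z y}
           → Eval (precC g h) (k ∷ xs) z → Eval h (k ∷ z ∷ xs) y
           → Eval (precC g h) (suc k ∷ xs) y
    emu : ∀ {n} {f : Code (suc n)} {xs y}
        → Eval f (y ∷ xs) 0
        → (∀ z → z < y → Σ ℕ (λ k → Eval f (z ∷ xs) (suc k)))
        → Eval (muC f) xs y

  data EvalVec : ∀ {m n} → Vec (Code n) m → Vec ℕ n → Vec ℕ m → Set where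
    []  : ∀ {n} {xs : Vec ℕ n} → EvalVec [] xs []
    _∷_ : ∀ {m n} {g : Code n} {gs : Vec (Code n) m} {xs y ys}
        → Eval g xs y → EvalVec gs xs ys → EvalVec (g ∷ gs) xs (y ∷ ys)

Computable : (ℕ → ℕ) → Set
Computable f = Σ (Code 1) (λ c → ∀ x → Eval c (x ∷ []) (f x))

ComputableSet : (ℕ → Set) → Set
ComputableSet U = Σ (ℕ → ℕ) (λ χ → Computable χ × (∀ x → (U x → χ x ≡ 1) × (χ x ≡ 1 → U x)))

-- pairing: fixed Cantor-style enumeration of ℕ × ℕ (diagonal walk);
-- unpair n = (π₁ n , π₂ n) is a computable bijection ℕ → ℕ × ℕ and
-- ⟨x , y⟩ is its inverse.

unpair : ℕ → ℕ × ℕ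
unpair zero = 0 , 0
unpair (suc n) with unpair n
... | zero , y = suc y , 0
... | suc x , y = x , suc y

π₁ π₂ : ℕ → ℕ
π₁ n = proj₁ (unpair n)
π₂ n = proj₂ (unpair n)

MRigid : (ℕ → Set) → Set
MRigid A = ∀ (f : ℕ → ℕ) → Computable f → (∀ x → A x ⇔ A (f x))
         → Σ ℕ (λ N → ∀ x → N ≤ x → f x ≡ x)

_≤₁_ : (ℕ → Set) → (ℕ → Set) → Set
X ≤₁ Y = Σ (ℕ → ℕ) (λ f → Computable f × Injective _≡_ _≡_ f × (∀ x → X x ⇔ Y (f x)))

Infinite : (ℕ → Set) → Set
Infinite P = ∀ N → Σ ℕ (λ x → N ≤ x × P x)

E : (ℕ → Set) → ℕ → Set
E U n = π₂ n ≡ 0 ⊎ (π₂ n ≡ 1 × U (π₁ n))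

IsEnum : (ℕ → Set) → (ℕ → ℕ) → Set
IsEnum U τ = Computable τ × (∀ n → E U (τ n)) × Injective _≡_ _≡_ τ
           × (∀ m → E U m → Σ ℕ (λ n → τ n ≡ m))

C : (ℕ → Set) → (ℕ → ℕ) → ℕ → Set
C A τ n = A (π₁ (τ n))

module Submission where

open import Defs
open import Data.Nat using (ℕ; zero; suc; _+_; _∸_; _≤_; _<_; pred; z≤n; s≤s)
open import Data.Nat.Base using (∣_-_∣; ≢-nonZero)
open import Data.Nat.Properties
open import Data.Fin using (#_)
open import Data.Vec using (Vec; []; _∷_)
open import Data.Product using (Σ; _×_; _,_; proj₁; proj₂; uncurry)
open import Data.Sum using (_⊎_; inj₁; inj₂)
open import Function.Base using (_∘_)
open import Function.Bundles using (_⇔_)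
open import Function.Definitions using (Injective)
open import Relation.Binary.PropositionalEquality
open import Relation.Nullary using (¬_; contradiction)

-- Suppose f witnesses C_T ≤₁ C_S.  For each computable "flag" b with ⟨x, b x⟩ ∈ E_T,
-- the column map x ↦ π₁ (τ_S (f (τ_T⁻¹ ⟨x, b x⟩))) is computable and preserves A,
-- so by m-rigidity it is eventually the identity.  Take the flags 0 and [x ∈ T] and
-- a large x ∈ T ∖ S: both columns send x to x, and since x ∉ S the only element of
-- E_S over x is ⟨x, 0⟩.  So f identifies the τ_T-indices of ⟨x, 0⟩ and ⟨x, 1⟩,
-- contradicting injectivity.

open ≡-Reasoning

addC : Code 2
addC = precC (projC (# 0)) (compC succC (projC (# 1) ∷ []))

add-eval : ∀ a b → Eval addC (a ∷ b ∷ []) (a + b)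
add-eval zero    b = eprec0 (eproj (# 0))
add-eval (suc a) b = eprecS (add-eval a b) (ecomp (eproj (# 1) ∷ []) esucc)

predC : Code 1
predC = precC zeroC (projC (# 0))

pred-eval : ∀ a → Eval predC (a ∷ []) (pred a)
pred-eval zero    = eprec0 ezero
pred-eval (suc a) = eprecS (pred-eval a) (eproj (# 0))

-- Recursion is on the first argument, so this computes the flipped subtraction.
monusC : Code 2
monusC = precC (projC (# 0)) (compC predC (projC (# 1) ∷ []))

monus-eval : ∀ b a → Eval monusC (b ∷ a ∷ []) (a ∸ b)
monus-eval zero    a = eprec0 (eproj (# 0))
monus-eval (suc b) a =
  subst (Eval monusC (suc b ∷ a ∷ [])) (pred[m∸n]≡m∸[1+n] a b)
    (eprecS (monus-eval b a) (ecomp (eproj (# 1) ∷ []) (pred-eval (a ∸ b))))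

subC : Code 2
subC = compC monusC (projC (# 1) ∷ projC (# 0) ∷ [])

sub-eval : ∀ a b → Eval subC (a ∷ b ∷ []) (a ∸ b)
sub-eval a b = ecomp (eproj (# 1) ∷ eproj (# 0) ∷ []) (monus-eval b a)

module _ {n : ℕ} where

  infixl 6 _+ᶜ_ _∸ᶜ_
  infixr 9 _∘ᶜ_

  _+ᶜ_ _∸ᶜ_ : Code n → Code n → Code n
  c +ᶜ d = compC addC (c ∷ d ∷ [])
  c ∸ᶜ d = compC subC (c ∷ d ∷ [])

  ∣_-_∣ᶜ : Code n → Code n → Code n
  ∣ c - d ∣ᶜ = (c ∸ᶜ d) +ᶜ (d ∸ᶜ c)

  _∘ᶜ_ : Code 1 → Code n → Code n
  g ∘ᶜ c = compC g (c ∷ [])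

module _ {n : ℕ} {xs : Vec ℕ n} where

  +ᶜ-eval : ∀ {c d a b} → Eval c xs a → Eval d xs b → Eval (c +ᶜ d) xs (a + b)
  +ᶜ-eval c⇓ d⇓ = ecomp (c⇓ ∷ d⇓ ∷ []) (add-eval _ _)

  ∸ᶜ-eval : ∀ {c d a b} → Eval c xs a → Eval d xs b → Eval (c ∸ᶜ d) xs (a ∸ b)
  ∸ᶜ-eval c⇓ d⇓ = ecomp (c⇓ ∷ d⇓ ∷ []) (sub-eval _ _)

  ∣-∣ᶜ-eval : ∀ {c d a b} → Eval c xs a → Eval d xs b → Eval ∣ c - d ∣ᶜ xs ∣ a - b ∣
  ∣-∣ᶜ-eval {a = a} {b} c⇓ d⇓ =
    subst (Eval _ xs) (sym (∣m-n∣≡m∸n+n∸m a b)) (+ᶜ-eval (∸ᶜ-eval c⇓ d⇓) (∸ᶜ-eval d⇓ c⇓))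
    where
    ∣m-n∣≡m∸n+n∸m : ∀ m k → ∣ m - k ∣ ≡ (m ∸ k) + (k ∸ m)
    ∣m-n∣≡m∸n+n∸m zero    k       = sym (cong (_+ k) (0∸n≡0 k))
    ∣m-n∣≡m∸n+n∸m (suc m) zero    = sym (+-identityʳ (suc m))
    ∣m-n∣≡m∸n+n∸m (suc m) (suc k) = ∣m-n∣≡m∸n+n∸m m k

  ∘ᶜ-eval : ∀ {g c a b} → Eval c xs a → Eval g (a ∷ []) b → Eval (g ∘ᶜ c) xs b
  ∘ᶜ-eval c⇓ g⇓ = ecomp (c⇓ ∷ []) g⇓

  muC-least : ∀ {c : Code (suc n)} (v : ℕ → ℕ) → (∀ z → Eval c (z ∷ xs) (v z))
            → ∀ {y} → v y ≡ 0 → (∀ z → z < y → v z ≢ 0) → Eval (muC c) xs y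
  muC-least {c} v c⇓ vy≡0 v≢0 =
    emu (subst (Eval c _) vy≡0 (c⇓ _)) λ z z<y →
      pred (v z) , subst (Eval c _) (sym (suc-pred (v z) {{≢-nonZero (v≢0 z z<y)}})) (c⇓ z)

Computable-∘ : ∀ {g h} → Computable g → Computable h → Computable (g ∘ h)
Computable-∘ {g} {h} (cg , g⇓) (ch , h⇓) = cg ∘ᶜ ch , λ x → ∘ᶜ-eval (h⇓ x) (g⇓ (h x))

-- Unbounded search for the preimage; injectivity makes the first hit the given one.
inverse-computable : ∀ {τ t} → Computable τ → Injective _≡_ _≡_ τ → Computable t
                   → (preimage : ∀ x → Σ ℕ λ n → τ n ≡ t x)
                   → Computable (λ x → proj₁ (preimage x))
inverse-computable {τ} {t} (cτ , τ⇓) τ-injective (ct , t⇓) preimage =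
  muC ∣ cτ ∘ᶜ projC (# 0) - ct ∘ᶜ projC (# 1) ∣ᶜ , λ x →
    muC-least (λ z → ∣ τ z - t x ∣)
      (λ z → ∣-∣ᶜ-eval (∘ᶜ-eval (eproj (# 0)) (τ⇓ z)) (∘ᶜ-eval (eproj (# 1)) (t⇓ x)))
      (m≡n⇒∣m-n∣≡0 (proj₂ (preimage x)))
      (λ z z<n ∣τz-tx∣≡0 → <⇒≢ z<n
        (τ-injective (trans (∣m-n∣≡0⇒m≡n ∣τz-tx∣≡0) (sym (proj₂ (preimage x))))))

tri : ℕ → ℕ
tri zero    = 0
tri (suc k) = suc (k + tri k)

tri-mono-≤ : ∀ {m n} → m ≤ n → tri m ≤ tri n
tri-mono-≤ {zero}          _         = z≤n
tri-mono-≤ {suc m} {suc n} (s≤s m≤n) = s≤s (+-mono-≤ m≤n (tri-mono-≤ m≤n))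

triC : Code 1
triC = precC zeroC (succC ∘ᶜ (projC (# 0) +ᶜ projC (# 1)))

tri-eval : ∀ k → Eval triC (k ∷ []) (tri k)
tri-eval zero    = eprec0 ezero
tri-eval (suc k) = eprecS (tri-eval k) (∘ᶜ-eval (+ᶜ-eval (eproj (# 0)) (eproj (# 1))) esucc)

-- The inverse of unpair: diagonal x + y starts at index tri (x + y) with (x + y , 0).
pair : ℕ → ℕ → ℕ
pair x y = tri (x + y) + y

step : ℕ × ℕ → ℕ × ℕ
step (zero  , y) = suc y , 0
step (suc x , y) = x , suc y

unpair-suc : ∀ n → unpair (suc n) ≡ step (unpair n)
unpair-suc n with unpair n
... | zero  , y = refl
... | suc x , y = refl

pair-step : ∀ p → uncurry pair (step p) ≡ suc (uncurry pair p)
pair-step (zero , y) = begin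
  tri (suc y + 0) + 0   ≡⟨ +-identityʳ _ ⟩
  tri (suc y + 0)       ≡⟨ cong tri (+-identityʳ (suc y)) ⟩
  suc (y + tri y)       ≡⟨ cong suc (+-comm y (tri y)) ⟩
  suc (tri y + y)       ∎
pair-step (suc x , y) = begin
  tri (x + suc y) + suc y     ≡⟨ cong (λ d → tri d + suc y) (+-suc x y) ⟩
  tri (suc (x + y)) + suc y   ≡⟨ +-suc _ y ⟩
  suc (tri (suc x + y) + y)   ∎

pair-unpair : ∀ n → pair (π₁ n) (π₂ n) ≡ n
pair-unpair zero    = refl
pair-unpair (suc n) = begin
  uncurry pair (unpair (suc n))  ≡⟨ cong (uncurry pair) (unpair-suc n) ⟩
  uncurry pair (step (unpair n)) ≡⟨ pair-step (unpair n) ⟩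
  suc (pair (π₁ n) (π₂ n))       ≡⟨ cong suc (pair-unpair n) ⟩
  suc n                          ∎

-- The fuel d = x + y makes the recursion lexicographic in (d , y).
unpair-pair : ∀ x y → unpair (pair x y) ≡ (x , y)
unpair-pair x y = along-diagonal (x + y) x y refl
  where
  along-diagonal : ∀ d x y → x + y ≡ d → unpair (pair x y) ≡ (x , y)
  along-diagonal d x (suc y) x+y≡d = begin
    unpair (pair x (suc y))        ≡⟨ cong unpair (pair-step (suc x , y)) ⟩
    unpair (suc (pair (suc x) y))  ≡⟨ unpair-suc (pair (suc x) y) ⟩
    step (unpair (pair (suc x) y))
      ≡⟨ cong step (along-diagonal d (suc x) y (trans (sym (+-suc x y)) x+y≡d)) ⟩
    (x , suc y)                    ∎
  along-diagonal d       zero    zero _ = refl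
  along-diagonal (suc d) (suc x) zero x+0≡d = begin
    unpair (pair (suc x) 0)        ≡⟨ cong unpair (pair-step (zero , x)) ⟩
    unpair (suc (pair 0 x))        ≡⟨ unpair-suc (pair 0 x) ⟩
    step (unpair (pair 0 x))
      ≡⟨ cong step (along-diagonal d 0 x (suc-injective (trans (sym (+-identityʳ (suc x))) x+0≡d))) ⟩
    (suc x , 0)                    ∎

π₁-pair : ∀ x y → π₁ (pair x y) ≡ x
π₁-pair x y = cong proj₁ (unpair-pair x y)

π₂-pair : ∀ x y → π₂ (pair x y) ≡ y
π₂-pair x y = cong proj₂ (unpair-pair x y)

pairC : Code 2
pairC = (triC ∘ᶜ (projC (# 0) +ᶜ projC (# 1))) +ᶜ projC (# 1)

graph-computable : ∀ {b} → Computable b → Computable (λ x → pair x (b x))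
graph-computable {b} (cb , b⇓) =
  compC pairC (projC (# 0) ∷ cb ∷ []) , λ x →
    ecomp (eproj (# 0) ∷ b⇓ x ∷ [])
      (+ᶜ-eval (∘ᶜ-eval (+ᶜ-eval (eproj (# 0)) (eproj (# 1))) (tri-eval (x + b x))) (eproj (# 1)))

diagonal : ℕ → ℕ
diagonal n = π₁ n + π₂ n

below-next-diagonal : ∀ n → n < tri (suc (diagonal n))
below-next-diagonal n = subst (_< tri (suc (diagonal n))) (pair-unpair n)
  (s≤s (≤-trans (+-monoʳ-≤ (tri (diagonal n)) (m≤n+m (π₂ n) (π₁ n)))
                (≤-reflexive (+-comm (tri (diagonal n)) (diagonal n)))))

above-earlier-diagonals : ∀ n {z} → z < diagonal n → tri (suc z) ≤ n
above-earlier-diagonals n {z} z<d = subst (tri (suc z) ≤_) (pair-unpair n)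
  (≤-trans (tri-mono-≤ z<d) (m≤m+n (tri (diagonal n)) (π₂ n)))

-- The diagonal of n is the least d with n < tri (suc d).
diagonalC : Code 1
diagonalC = muC ((succC ∘ᶜ projC (# 1)) ∸ᶜ (triC ∘ᶜ succC ∘ᶜ projC (# 0)))

diagonal-eval : ∀ n → Eval diagonalC (n ∷ []) (diagonal n)
diagonal-eval n =
  muC-least (λ z → suc n ∸ tri (suc z))
    (λ z → ∸ᶜ-eval (∘ᶜ-eval (eproj (# 1)) esucc)
                   (∘ᶜ-eval (∘ᶜ-eval (eproj (# 0)) esucc) (tri-eval (suc z))))
    (m≤n⇒m∸n≡0 (below-next-diagonal n))
    (λ z z<d → n>0⇒n≢0 (m<n⇒0<n∸m (s≤s (above-earlier-diagonals n z<d))))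

π₁-computable : Computable π₁
π₁-computable =
  diagonalC ∸ᶜ (projC (# 0) ∸ᶜ (triC ∘ᶜ diagonalC)) , λ n →
    subst (Eval _ (n ∷ [])) (π₁-from-diagonal n)
      (∸ᶜ-eval (diagonal-eval n) (∸ᶜ-eval (eproj (# 0)) (∘ᶜ-eval (diagonal-eval n) (tri-eval _))))
  where
  π₁-from-diagonal : ∀ n → diagonal n ∸ (n ∸ tri (diagonal n)) ≡ π₁ n
  π₁-from-diagonal n = begin
    diagonal n ∸ (n ∸ tri (diagonal n))
      ≡⟨ cong (λ m → diagonal n ∸ (m ∸ tri (diagonal n))) (sym (pair-unpair n)) ⟩
    diagonal n ∸ (tri (diagonal n) + π₂ n ∸ tri (diagonal n))
      ≡⟨ cong (diagonal n ∸_) (m+n∸m≡n (tri (diagonal n)) (π₂ n)) ⟩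
    diagonal n ∸ π₂ n
      ≡⟨ m+n∸n≡m (π₁ n) (π₂ n) ⟩
    π₁ n ∎

isOne : ℕ → ℕ
isOne 1 = 1
isOne _ = 0

isOne-computable : Computable isOne
isOne-computable =
  one ∸ᶜ ∣ projC (# 0) - one ∣ᶜ , λ m →
    subst (Eval _ (m ∷ [])) (1∸∣m-1∣≡isOne m)
      (∸ᶜ-eval (∘ᶜ-eval ezero esucc) (∣-∣ᶜ-eval (eproj (# 0)) (∘ᶜ-eval ezero esucc)))
  where
  one : Code 1
  one = succC ∘ᶜ zeroC
  1∸∣m-1∣≡isOne : ∀ m → 1 ∸ ∣ m - 1 ∣ ≡ isOne m
  1∸∣m-1∣≡isOne zero          = refl
  1∸∣m-1∣≡isOne (suc zero)    = refl
  1∸∣m-1∣≡isOne (suc (suc k)) = 0∸n≡0 k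

pair∈E : ∀ {U} x b → b ≡ 0 ⊎ (b ≡ 1 × U x) → E U (pair x b)
pair∈E x b (inj₁ b≡0)        = inj₁ (trans (π₂-pair x b) b≡0)
pair∈E {U} x b (inj₂ (b≡1 , Ux)) =
  inj₂ (trans (π₂-pair x b) b≡1 , subst U (sym (π₁-pair x b)) Ux)

isOne-flag∈E : ∀ {U : ℕ → Set} (χ : ℕ → ℕ) → (∀ x → χ x ≡ 1 → U x)
             → ∀ x → E U (pair x (isOne (χ x)))
isOne-flag∈E {U} χ χ≡1⇒U x = pair∈E {U} x (isOne (χ x)) (flag (χ x) (χ≡1⇒U x))
  where
  flag : ∀ m {P : Set} → (m ≡ 1 → P) → isOne m ≡ 0 ⊎ (isOne m ≡ 1 × P)
  flag zero          _      = inj₁ refl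
  flag (suc zero)    m≡1⇒P = inj₂ (refl , m≡1⇒P refl)
  flag (suc (suc _)) _      = inj₁ refl

E-outside⇒pair-0 : ∀ {U m} → E U m → ¬ U (π₁ m) → pair (π₁ m) 0 ≡ m
E-outside⇒pair-0 {m = m} (inj₁ π₂m≡0)      _     = subst (λ y → pair (π₁ m) y ≡ m) π₂m≡0 (pair-unpair m)
E-outside⇒pair-0         (inj₂ (_ , Uπ₁m)) ¬Uπ₁m = contradiction Uπ₁m ¬Uπ₁m

Eventually : (ℕ → Set) → Set
Eventually P = Σ ℕ λ N → ∀ x → N ≤ x → P x

Eventually-× : ∀ {P Q} → Eventually P → Eventually Q → Eventually (λ x → P x × Q x)
Eventually-× (M , P≥M) (N , Q≥N) =
  M + N , λ x M+N≤x → P≥M x (≤-trans (m≤m+n M N) M+N≤x) , Q≥N x (≤-trans (m≤n+m N M) M+N≤x)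

Infinite-Eventually : ∀ {P Q} → Infinite P → Eventually Q → Σ ℕ λ x → P x × Q x
Infinite-Eventually P-infinite (N , Q≥N) with P-infinite N
... | x , N≤x , Px = x , Px , Q≥N x N≤x

module Columns {A S T : ℕ → Set} {τS τT f : ℕ → ℕ}
  (f-reduces : ∀ n → C A τT n ⇔ C A τS (f n))
  (τT-onto : ∀ m → E T m → Σ ℕ λ n → τT n ≡ m) where

  index : (b : ℕ → ℕ) → (∀ x → E T (pair x (b x))) → ℕ → ℕ
  index b b∈E x = proj₁ (τT-onto (pair x (b x)) (b∈E x))

  τT-index : ∀ b b∈E x → τT (index b b∈E x) ≡ pair x (b x)
  τT-index b b∈E x = proj₂ (τT-onto (pair x (b x)) (b∈E x))

  column : (b : ℕ → ℕ) → (∀ x → E T (pair x (b x))) → ℕ → ℕ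
  column b b∈E = π₁ ∘ τS ∘ f ∘ index b b∈E

  column-computable : Computable τS → Computable f → Computable τT → Injective _≡_ _≡_ τT
                    → ∀ {b} b∈E → Computable b → Computable (column b b∈E)
  column-computable τS-computable f-computable τT-computable τT-injective {b} b∈E b-computable =
    Computable-∘ π₁-computable (Computable-∘ τS-computable (Computable-∘ f-computable
      (inverse-computable τT-computable τT-injective (graph-computable b-computable)
        (λ x → τT-onto (pair x (b x)) (b∈E x)))))

  column-preserves : ∀ b b∈E x → A x ⇔ A (column b b∈E x)
  column-preserves b b∈E x =
    subst (λ y → A y ⇔ A (column b b∈E x))
      (trans (cong π₁ (τT-index b b∈E x)) (π₁-pair x (b x)))
      (f-reduces (index b b∈E x))

  column-over-outside : (∀ n → E S (τS n)) → ∀ b b∈E x → ¬ S x → column b b∈E x ≡ x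
                      → τS (f (index b b∈E x)) ≡ pair x 0
  column-over-outside τS∈E b b∈E x ¬Sx fixed =
    trans (sym (E-outside⇒pair-0 {S} (τS∈E _) (subst (λ y → ¬ S y) (sym fixed) ¬Sx)))
          (cong (λ y → pair y 0) fixed)

  fixed-columns-agree : (∀ n → E S (τS n)) → Injective _≡_ _≡_ τS → Injective _≡_ _≡_ f
                      → ∀ b b∈E b′ b′∈E x → ¬ S x
                      → column b b∈E x ≡ x → column b′ b′∈E x ≡ x → b x ≡ b′ x
  fixed-columns-agree τS∈E τS-injective f-injective b b∈E b′ b′∈E x ¬Sx fixed fixed′ = begin
    b x                         ≡⟨ sym (π₂-pair x (b x)) ⟩
    π₂ (pair x (b x))           ≡⟨ cong π₂ (sym (τT-index b b∈E x)) ⟩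
    π₂ (τT (index b b∈E x))     ≡⟨ cong (π₂ ∘ τT) same-index ⟩
    π₂ (τT (index b′ b′∈E x))   ≡⟨ cong π₂ (τT-index b′ b′∈E x) ⟩
    π₂ (pair x (b′ x))          ≡⟨ π₂-pair x (b′ x) ⟩
    b′ x                        ∎
    where
    same-index : index b b∈E x ≡ index b′ b′∈E x
    same-index = f-injective (τS-injective (trans (column-over-outside τS∈E b b∈E x ¬Sx fixed)
                                              (sym (column-over-outside τS∈E b′ b′∈E x ¬Sx fixed′))))

theorem6p4 : (A S T : ℕ → Set) → MRigid A → ComputableSet S → ComputableSet T
    → Infinite (λ x → T x × ¬ S x)
    → (τS τT : ℕ → ℕ) → IsEnum S τS → IsEnum T τT
    → ¬ (C A τT ≤₁ C A τS)
theorem6p4 A S T A-rigid _ (χ , χ-computable , χ-spec) T∖S-infinite τS τT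
  (τS-computable , τS∈E , τS-injective , _) (τT-computable , _ , τT-injective , τT-onto)
  (f , f-computable , f-injective , f-reduces) =
  let x , (Tx , ¬Sx) , (fixed₀ , fixed₁) =
        Infinite-Eventually T∖S-infinite
          (Eventually-× (fixes unflagged (zeroC , λ _ → ezero))
                        (fixes flagged (Computable-∘ isOne-computable χ-computable)))
  in 0≢1+n (trans (fixed-columns-agree τS∈E τS-injective f-injective _ unflagged _ flagged x ¬Sx
                                       fixed₀ fixed₁)
                  (cong isOne (proj₁ (χ-spec x) Tx)))
  where
  open Columns {A} {S} {T} {τS} {τT} {f} f-reduces τT-onto

  unflagged : ∀ x → E T (pair x 0)
  unflagged x = pair∈E {T} x 0 (inj₁ refl)

  flagged : ∀ x → E T (pair x (isOne (χ x)))
  flagged = isOne-flag∈E χ (proj₂ ∘ χ-spec)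

  fixes : ∀ {b} (b∈E : ∀ x → E T (pair x (b x))) → Computable b
        → Eventually (λ x → column b b∈E x ≡ x)
  fixes b∈E b-computable =
    A-rigid _ (column-computable τS-computable f-computable τT-computable τT-injective
                                 b∈E b-computable)
              (column-preserves _ b∈E)
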